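{- Let $n\geq 1$ and let $S\subseteq \{0,1\}^n$ be a cube-ideal set-system with connectivity $\lambda$, where $\lambda\geq 3$. Then $|S|\geq 2^{(1-H(1/\lambda))n}$.
   Context: A set-system is a subset $S\subseteq\{0,1\}^n$; $\mathrm{conv}(S)$ denotes its convex hull. A capacity inequality is one of $x_i\geq 0$ or $x_i\leq 1$. A generalized set covering (GSC) inequality is an inequality $\sum_{i\in I}x_i+\sum_{j\in J}(1-x_j)\geq 1$ for disjoint $I,J\subseteq[n]$; it uses (involves) $|I|+|J|$ variables. $S$ is cube-ideal if $\mathrm{conv}(S)$ equals the set of points of $\mathbb{R}^n$ satisfying some finite family of capacity and GSC inequalities. The connectivity of $S$ is the minimum number of variables used in a GSC inequality valid for $\mathrm{conv}(S)$, and is $+\infty$ if $S=\{0,1\}^n$. $H:[0,\tfrac12]\to[0,1]$ is the binary entropy function $H(\varepsilon)=-\varepsilon\log_2\varepsilon-(1-\varepsilon)\log_2(1-\varepsilon)$ for $\varepsilon>0$, $H(0)=0$.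
   Formalization: Points of conv(S), and the points on which the cube-ideal description and the validity of GSC inequalities are tested, have rational coordinates, ranging over ℚ^n instead of ℝ^n. -}

module Defs where

open import Data.Bool using (Bool; true; false; T; if_then_else_)
open import Data.Nat as ℕ using (ℕ; zero; suc; _^_; _∸_)
open import Data.Fin using (Fin)
open import Data.Fin.Subset using (Subset; _∈_; _∉_; ∣_∣)
open import Data.Vec using (Vec; []; _∷_; lookup)
open import Data.List using (List; []; _∷_; map; _++_; length; filter)
open import Data.List.Relation.Unary.All using (All)
open import Data.Product using (Σ; _×_; _,_; ∃)
open import Data.Sum using (_⊎_)
open import Data.Rational as ℚ using (ℚ; 0ℚ; 1ℚ)
open import Relation.Binary.PropositionalEquality using (_≡_)
open import Relation.Unary using (Pred)
open import Function using (_⇔_)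
open import Level using (0ℓ)

-- The discrete cube {0,1}^n, points encoded as Boolean vectors (true = 1).
Cube : ℕ → Set
Cube n = Vec Bool n

SetSystem : ℕ → Set
SetSystem n = Cube n → Bool

allCube : (n : ℕ) → List (Cube n)
allCube zero    = [] ∷ []
allCube (suc n) = map (false ∷_) (allCube n) ++ map (true ∷_) (allCube n)

card : {n : ℕ} → SetSystem n → ℕ
card {n} S = length (filter (λ v → Data.Bool._≟_ (S v) true) (allCube n))
  where import Data.Bool

Point : ℕ → Set
Point n = Fin n → ℚ

bit : Bool → ℚ
bit true  = 1ℚ
bit false = 0ℚ

embed : {n : ℕ} → Cube n → Point n
embed v i = bit (lookup v i)

sumFin : {n : ℕ} → (Fin n → ℚ) → ℚ
sumFin {zero}  f = 0ℚ
sumFin {suc n} f = f Fin.zero ℚ.+ sumFin (λ i → f (Fin.suc i))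
  where import Data.Fin as Fin

-- Convex hull: x ∈ conv(S) iff x is a convex combination of finitely many points of S.
sumW : {n : ℕ} → List (ℚ × Cube n) → ℚ
sumW []            = 0ℚ
sumW ((w , _) ∷ l) = w ℚ.+ sumW l

combo : {n : ℕ} → List (ℚ × Cube n) → Point n
combo []            i = 0ℚ
combo ((w , v) ∷ l) i = (w ℚ.* embed v i) ℚ.+ combo l i

InConv : {n : ℕ} → SetSystem n → Point n → Set
InConv {n} S x =
  Σ (List (ℚ × Cube n)) λ ws →
    All (λ p → T (S (Data.Product.proj₂ p)) × 0ℚ ℚ.≤ Data.Product.proj₁ p) ws
    × sumW ws ≡ 1ℚ
    × (∀ i → x i ≡ combo ws i)
  where import Data.Product

-- Generalized set covering inequality Σ_{i∈I} x_i + Σ_{j∈J} (1 - x_j) ≥ 1, I, J disjoint.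
record GSC (n : ℕ) : Set where
  constructor gsc
  field
    I        : Subset n
    J        : Subset n
    disjoint : ∀ i → i ∈ I → i ∉ J

gscSize : {n : ℕ} → GSC n → ℕ
gscSize g = ∣ GSC.I g ∣ ℕ.+ ∣ GSC.J g ∣

indicator : {n : ℕ} → Subset n → Fin n → Bool
indicator P i = lookup P i

gscLHS : {n : ℕ} → GSC n → Point n → ℚ
gscLHS g x =
  sumFin (λ i → if indicator (GSC.I g) i then x i else 0ℚ)
  ℚ.+ sumFin (λ j → if indicator (GSC.J g) j then 1ℚ ℚ.- x j else 0ℚ)

SatGSC : {n : ℕ} → GSC n → Point n → Set
SatGSC g x = 1ℚ ℚ.≤ gscLHS g x

data Ineq (n : ℕ) : Set where
  lower : Fin n → Ineq n
  upper : Fin n → Ineq n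
  cover : GSC n → Ineq n

Sat : {n : ℕ} → Ineq n → Point n → Set
Sat (lower i) x = 0ℚ ℚ.≤ x i
Sat (upper i) x = x i ℚ.≤ 1ℚ
Sat (cover g) x = SatGSC g x

CubeIdeal : {n : ℕ} → SetSystem n → Set
CubeIdeal {n} S =
  Σ (List (Ineq n)) λ F → ∀ (x : Point n) → (InConv S x → All (λ e → Sat e x) F)
                                           × (All (λ e → Sat e x) F → InConv S x)

ValidGSC : {n : ℕ} → SetSystem n → GSC n → Set
ValidGSC S g = ∀ x → InConv S x → SatGSC g x

data ℕ∞ : Set where
  fin : ℕ → ℕ∞
  ∞   : ℕ∞

Connectivity : {n : ℕ} → SetSystem n → ℕ∞ → Set
Connectivity S (fin k) =
  (Σ (GSC _) λ g → ValidGSC S g × gscSize g ≡ k)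
  × (∀ g → ValidGSC S g → k ℕ.≤ gscSize g)
Connectivity S ∞ = ∀ v → T (S v)

_≤∞_ : ℕ → ℕ∞ → Set
k ≤∞ fin m = k ℕ.≤ m
k ≤∞ ∞     = Data.Unit.⊤
  where import Data.Unit

-- The bound |S| ≥ 2^{(1 - H(1/λ)) n}, written in integer arithmetic.
-- For finite λ ≥ 2: 2^{(1-H(1/λ))n} = 2^n ((λ-1)^{λ-1} / λ^λ)^{n/λ}, so raising to the
-- power λ the bound reads |S|^λ · λ^{λn} ≥ 2^{λn} · (λ-1)^{(λ-1)n}.
-- For λ = +∞: H(0) = 0, the bound is |S| ≥ 2^n.
EntropyBound : ℕ → ℕ∞ → ℕ → Set
EntropyBound n (fin l) s = 2 ^ (l ℕ.* n) ℕ.* (l ∸ 1) ^ ((l ∸ 1) ℕ.* n) ℕ.≤ s ^ l ℕ.* l ^ (l ℕ.* n)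
EntropyBound n ∞ s = 2 ^ n ℕ.≤ s

{-# OPTIONS --safe #-}
module Submission where

-- Let r = 1/λ. For a vertex y of the cube, the point x with x_i = 1 - r where y_i = 1 and
-- x_i = r elsewhere satisfies the capacity inequalities, and every GSC inequality on at
-- least λ variables because each of its terms is at least r. As S is cube-ideal with
-- connectivity λ, x lies in conv(S). The ℓ₁-distance from y is affine on [0,1]^n, is the
-- Hamming distance at vertices and equals nr = n/λ at x, so some s ∈ S has d(s, y) ≤ n/λ.
-- Hence the Hamming balls of radius k = ⌊n/λ⌋ around S cover the cube, 2^n ≤ |S| V(n, k).
-- Weighting each y by (λ-1)^(n-|y|), in total λ^n, gives V(n, k) (λ-1)^(n-k) ≤ λ^n, and
-- eliminating V(n, k) yields the bound.

open import Defs

open import Data.Bool using (Bool; true; false; T; if_then_else_; _xor_; _≟_)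
open import Data.List using (List; []; _∷_; _++_; map; length; filter)
open import Data.List.Membership.Propositional using (_∈_)
open import Data.List.Membership.Propositional.Properties using (∈-map⁺; ∈-++⁺ˡ; ∈-++⁺ʳ)
open import Data.List.Relation.Unary.Any using (here; there)
open import Data.Product using (_×_; _,_; ∃-syntax)
open import Data.Vec using (_∷_; []; lookup; replicate)
open import Function using (_∘_)
open import Relation.Binary.PropositionalEquality
  using (_≡_; _≗_; refl; sym; trans; cong; cong₂; subst; module ≡-Reasoning)

module SphereCovering where

  open import Data.Nat using (ℕ; zero; suc; _+_; _*_; _^_; _∸_; _≤_; _≤ᵇ_; z≤n; s≤s; NonZero)
  open import Data.Nat.Properties hiding (_≟_)
  open import Data.Nat.DivMod using (_/_; m*n/n≡m; /-monoˡ-≤)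
  open import Data.Nat.ListAction using (sum)
  open import Data.Nat.ListAction.Properties using (sum-++)
  open import Data.List.Properties using (map-++; map-∘; map-cong)
  open import Algebra.Properties.CommutativeSemigroup +-commutativeSemigroup using (interchange)

  private variable A B : Set

  ∑ : List A → (A → ℕ) → ℕ
  ∑ xs f = sum (map f xs)

  ∑-++ : ∀ (xs ys : List A) f → ∑ (xs ++ ys) f ≡ ∑ xs f + ∑ ys f
  ∑-++ xs ys f = trans (cong sum (map-++ f xs ys)) (sum-++ (map f xs) (map f ys))

  ∑-map : ∀ (g : A → B) xs f → ∑ (map g xs) f ≡ ∑ xs (f ∘ g)
  ∑-map g xs f = cong sum (sym (map-∘ xs))

  ∑-cong : ∀ xs {f g : A → ℕ} → f ≗ g → ∑ xs f ≡ ∑ xs g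
  ∑-cong xs f≗g = cong sum (map-cong f≗g xs)

  ∑-mono-≤ : ∀ xs {f g : A → ℕ} → (∀ x → f x ≤ g x) → ∑ xs f ≤ ∑ xs g
  ∑-mono-≤ []       f≤g = z≤n
  ∑-mono-≤ (x ∷ xs) f≤g = +-mono-≤ (f≤g x) (∑-mono-≤ xs f≤g)

  ∑-zero : ∀ xs → ∑ xs (λ (_ : A) → 0) ≡ 0
  ∑-zero []       = refl
  ∑-zero (_ ∷ xs) = ∑-zero xs

  ∑-+ : ∀ xs (f g : A → ℕ) → ∑ xs (λ x → f x + g x) ≡ ∑ xs f + ∑ xs g
  ∑-+ []       f g = refl
  ∑-+ (x ∷ xs) f g = trans (cong (f x + g x +_) (∑-+ xs f g)) (interchange (f x) (g x) (∑ xs f) (∑ xs g))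

  ∑-*ˡ : ∀ xs c (f : A → ℕ) → ∑ xs (λ x → c * f x) ≡ c * ∑ xs f
  ∑-*ˡ []       c f = sym (*-zeroʳ c)
  ∑-*ˡ (x ∷ xs) c f = trans (cong (c * f x +_) (∑-*ˡ xs c f)) (sym (*-distribˡ-+ c (f x) (∑ xs f)))

  ∑-*ʳ : ∀ xs c (f : A → ℕ) → ∑ xs (λ x → f x * c) ≡ ∑ xs f * c
  ∑-*ʳ xs c f = trans (∑-cong xs (λ x → *-comm (f x) c)) (trans (∑-*ˡ xs c f) (*-comm c (∑ xs f)))

  ∑-comm : ∀ xs (ys : List B) (f : A → B → ℕ) →
    ∑ xs (λ x → ∑ ys (f x)) ≡ ∑ ys (λ y → ∑ xs (λ x → f x y))
  ∑-comm []       ys f = sym (∑-zero ys)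
  ∑-comm (x ∷ xs) ys f = trans (cong (∑ ys (f x) +_) (∑-comm xs ys f)) (sym (∑-+ ys (f x) _))

  ∈⇒≤∑ : ∀ {x xs} (f : A → ℕ) → x ∈ xs → f x ≤ ∑ xs f
  ∈⇒≤∑ {xs = y ∷ xs} f (here refl) = m≤m+n (f y) (∑ xs f)
  ∈⇒≤∑ {xs = y ∷ xs} f (there x∈xs) = ≤-trans (∈⇒≤∑ f x∈xs) (m≤n+m (∑ xs f) (f y))

  ∑-allCube-suc : ∀ n (f : Cube (suc n) → ℕ) →
    ∑ (allCube (suc n)) f ≡ ∑ (allCube n) (f ∘ (false ∷_)) + ∑ (allCube n) (f ∘ (true ∷_))
  ∑-allCube-suc n f = trans (∑-++ (map (false ∷_) (allCube n)) _ f)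
    (cong₂ _+_ (∑-map (false ∷_) (allCube n) f) (∑-map (true ∷_) (allCube n) f))

  ∈-allCube : ∀ {n} (v : Cube n) → v ∈ allCube n
  ∈-allCube []                = here refl
  ∈-allCube {suc n} (false ∷ v) = ∈-++⁺ˡ (∈-map⁺ (false ∷_) (∈-allCube v))
  ∈-allCube {suc n} (true ∷ v)  = ∈-++⁺ʳ (map (false ∷_) (allCube n)) (∈-map⁺ (true ∷_) (∈-allCube v))

  ∑-allCube-1 : ∀ n → ∑ (allCube n) (λ _ → 1) ≡ 2 ^ n
  ∑-allCube-1 zero    = refl
  ∑-allCube-1 (suc n) = trans (∑-allCube-suc n (λ _ → 1))
    (cong₂ _+_ (∑-allCube-1 n) (trans (∑-allCube-1 n) (sym (+-identityʳ (2 ^ n)))))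

  𝟙 : Bool → ℕ
  𝟙 b = if b then 1 else 0

  T⇒𝟙≡1 : ∀ {b} → T b → 𝟙 b ≡ 1
  T⇒𝟙≡1 {true} _ = refl

  𝟙*-≤ : ∀ b {x y} → (T b → x ≤ y) → 𝟙 b * x ≤ y
  𝟙*-≤ true  x≤y = ≤-trans (≤-reflexive (+-identityʳ _)) (x≤y _)
  𝟙*-≤ false _   = z≤n

  card≡∑𝟙 : ∀ {n} (S : SetSystem n) → card S ≡ ∑ (allCube n) (𝟙 ∘ S)
  card≡∑𝟙 {n} S = length-filter (allCube n)
    where
    length-filter : ∀ xs → length (filter (λ v → S v ≟ true) xs) ≡ ∑ xs (𝟙 ∘ S)
    length-filter []       = refl
    length-filter (x ∷ xs) with S x
    ... | true  = cong suc (length-filter xs)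
    ... | false = length-filter xs

  full⇒2^n≤card : ∀ {n} (S : SetSystem n) → (∀ v → T (S v)) → 2 ^ n ≤ card S
  full⇒2^n≤card {n} S full = begin
    2 ^ n                    ≡⟨ ∑-allCube-1 n ⟨
    ∑ (allCube n) (λ _ → 1)  ≤⟨ ∑-mono-≤ (allCube n) (λ v → ≤-reflexive (sym (T⇒𝟙≡1 (full v)))) ⟩
    ∑ (allCube n) (𝟙 ∘ S)    ≡⟨ card≡∑𝟙 S ⟨
    card S                   ∎
    where open ≤-Reasoning

  hamming : ∀ {n} → Cube n → Cube n → ℕ
  hamming []      []      = 0
  hamming (a ∷ u) (b ∷ v) = 𝟙 (a xor b) + hamming u v

  weight : ∀ {n} → Cube n → ℕ
  weight = hamming (replicate _ false)

  weight≤n : ∀ {n} (y : Cube n) → weight y ≤ n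
  weight≤n []          = z≤n
  weight≤n (false ∷ y) = m≤n⇒m≤1+n (weight≤n y)
  weight≤n (true ∷ y)  = s≤s (weight≤n y)

  ∑-hamming-translate : ∀ {n} (s : Cube n) (P : ℕ → ℕ) →
    ∑ (allCube n) (P ∘ hamming s) ≡ ∑ (allCube n) (P ∘ weight)
  ∑-hamming-translate []                P = refl
  ∑-hamming-translate {suc n} (false ∷ s) P = begin
    ∑ (allCube (suc n)) (P ∘ hamming (false ∷ s))
      ≡⟨ ∑-allCube-suc n _ ⟩
    ∑ (allCube n) (P ∘ hamming s) + ∑ (allCube n) (P ∘ suc ∘ hamming s)
      ≡⟨ cong₂ _+_ (∑-hamming-translate s P) (∑-hamming-translate s (P ∘ suc)) ⟩
    ∑ (allCube n) (P ∘ weight) + ∑ (allCube n) (P ∘ suc ∘ weight)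
      ≡⟨ ∑-allCube-suc n _ ⟨
    ∑ (allCube (suc n)) (P ∘ weight) ∎
    where open ≡-Reasoning
  ∑-hamming-translate {suc n} (true ∷ s) P = begin
    ∑ (allCube (suc n)) (P ∘ hamming (true ∷ s))
      ≡⟨ ∑-allCube-suc n _ ⟩
    ∑ (allCube n) (P ∘ suc ∘ hamming s) + ∑ (allCube n) (P ∘ hamming s)
      ≡⟨ cong₂ _+_ (∑-hamming-translate s (P ∘ suc)) (∑-hamming-translate s P) ⟩
    ∑ (allCube n) (P ∘ suc ∘ weight) + ∑ (allCube n) (P ∘ weight)
      ≡⟨ +-comm (∑ (allCube n) (P ∘ suc ∘ weight)) _ ⟩
    ∑ (allCube n) (P ∘ weight) + ∑ (allCube n) (P ∘ suc ∘ weight)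
      ≡⟨ ∑-allCube-suc n _ ⟨
    ∑ (allCube (suc n)) (P ∘ weight) ∎
    where open ≡-Reasoning

  ballVolume : ℕ → ℕ → ℕ
  ballVolume n k = ∑ (allCube n) (λ y → 𝟙 (weight y ≤ᵇ k))

  sphere-covering-bound : ∀ {n} (S : SetSystem n) k →
    (∀ y → ∃[ s ] T (S s) × hamming s y ≤ k) → 2 ^ n ≤ card S * ballVolume n k
  sphere-covering-bound {n} S k covered = begin
    2 ^ n
      ≡⟨ ∑-allCube-1 n ⟨
    ∑ cube (λ _ → 1)
      ≤⟨ ∑-mono-≤ cube near ⟩
    ∑ cube (λ y → ∑ cube (λ s → 𝟙 (S s) * inBall s y))
      ≡⟨ ∑-comm cube cube (λ s y → 𝟙 (S s) * inBall s y) ⟨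
    ∑ cube (λ s → ∑ cube (λ y → 𝟙 (S s) * inBall s y))
      ≡⟨ ∑-cong cube (λ s → ∑-*ˡ cube (𝟙 (S s)) (inBall s)) ⟩
    ∑ cube (λ s → 𝟙 (S s) * ∑ cube (inBall s))
      ≡⟨ ∑-cong cube (λ s → cong (𝟙 (S s) *_) (∑-hamming-translate s (λ d → 𝟙 (d ≤ᵇ k)))) ⟩
    ∑ cube (λ s → 𝟙 (S s) * ballVolume n k)
      ≡⟨ ∑-*ʳ cube (ballVolume n k) (𝟙 ∘ S) ⟩
    ∑ cube (𝟙 ∘ S) * ballVolume n k
      ≡⟨ cong (_* ballVolume n k) (card≡∑𝟙 S) ⟨
    card S * ballVolume n k ∎
    where
    open ≤-Reasoning
    cube : List (Cube n)
    cube = allCube n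
    inBall : Cube n → Cube n → ℕ
    inBall s y = 𝟙 (hamming s y ≤ᵇ k)
    near : ∀ y → 1 ≤ ∑ cube (λ s → 𝟙 (S s) * inBall s y)
    near y with covered y
    ... | s , s∈S , close = begin
      1                                   ≡⟨ cong₂ _*_ (T⇒𝟙≡1 s∈S) (T⇒𝟙≡1 (≤⇒≤ᵇ close)) ⟨
      𝟙 (S s) * inBall s y                ≤⟨ ∈⇒≤∑ (λ s → 𝟙 (S s) * inBall s y) (∈-allCube s) ⟩
      ∑ cube (λ s → 𝟙 (S s) * inBall s y) ∎

  ∑-allCube-^[n∸weight] : ∀ m n → ∑ (allCube n) (λ y → m ^ (n ∸ weight y)) ≡ suc m ^ n
  ∑-allCube-^[n∸weight] m zero    = refl
  ∑-allCube-^[n∸weight] m (suc n) = begin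
    ∑ (allCube (suc n)) (λ y → m ^ (suc n ∸ weight y))
      ≡⟨ ∑-allCube-suc n _ ⟩
    ∑ cube (λ y → m ^ (suc n ∸ weight y)) + W
      ≡⟨ cong (_+ W) (∑-cong cube (λ y → cong (m ^_) (+-∸-assoc 1 (weight≤n y)))) ⟩
    ∑ cube (λ y → m * m ^ (n ∸ weight y)) + W
      ≡⟨ cong (_+ W) (∑-*ˡ cube m (λ y → m ^ (n ∸ weight y))) ⟩
    m * W + W
      ≡⟨ +-comm (m * W) W ⟩
    suc m * W
      ≡⟨ cong (suc m *_) (∑-allCube-^[n∸weight] m n) ⟩
    suc m ^ suc n ∎
    where
    open ≡-Reasoning
    cube : List (Cube n)
    cube = allCube n
    W : ℕ
    W = ∑ cube (λ y → m ^ (n ∸ weight y))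

  ballVolume-bound : ∀ m n k .{{_ : NonZero m}} → ballVolume n k * m ^ (n ∸ k) ≤ suc m ^ n
  ballVolume-bound m n k = begin
    ballVolume n k * m ^ (n ∸ k)
      ≡⟨ ∑-*ʳ (allCube n) (m ^ (n ∸ k)) _ ⟨
    ∑ (allCube n) (λ y → 𝟙 (weight y ≤ᵇ k) * m ^ (n ∸ k))
      ≤⟨ ∑-mono-≤ (allCube n) (λ y → 𝟙*-≤ (weight y ≤ᵇ k) (m^[n∸k]≤m^[n∸weight] y)) ⟩
    ∑ (allCube n) (λ y → m ^ (n ∸ weight y))
      ≡⟨ ∑-allCube-^[n∸weight] m n ⟩
    suc m ^ n ∎
    where
    open ≤-Reasoning
    m^[n∸k]≤m^[n∸weight] : ∀ y → T (weight y ≤ᵇ k) → m ^ (n ∸ k) ≤ m ^ (n ∸ weight y)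
    m^[n∸k]≤m^[n∸weight] y w≤k = ^-monoʳ-≤ m (∸-monoʳ-≤ n (≤ᵇ⇒≤ (weight y) k w≤k))

  m*n≤o⇒n≤o/m : ∀ m {n o} .{{_ : NonZero m}} → m * n ≤ o → n ≤ o / m
  m*n≤o⇒n≤o/m m {n} {o} m*n≤o = begin
    n         ≡⟨ m*n/n≡m n m ⟨
    n * m / m ≤⟨ /-monoˡ-≤ m (≤-trans (≤-reflexive (*-comm n m)) m*n≤o) ⟩
    o / m     ∎
    where open ≤-Reasoning

  ^-distribʳ-* : ∀ a b k → (a * b) ^ k ≡ a ^ k * b ^ k
  ^-distribʳ-* a b zero    = refl
  ^-distribʳ-* a b (suc k) = trans (cong (a * b *_) (^-distribʳ-* a b k)) ([m*n]*[o*p]≡[m*o]*[n*p] a b (a ^ k) (b ^ k))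

  m*n≤[n∸k]*[1+m] : ∀ m n k → k * suc m ≤ n → m * n ≤ (n ∸ k) * suc m
  m*n≤[n∸k]*[1+m] m n k k[1+m]≤n = begin
    m * n                 ≡⟨ *-comm m n ⟩
    n * m                 ≡⟨ m+n∸m≡n n (n * m) ⟨
    n + n * m ∸ n         ≡⟨ cong (_∸ n) (*-suc n m) ⟨
    n * suc m ∸ n         ≤⟨ ∸-monoʳ-≤ (n * suc m) k[1+m]≤n ⟩
    n * suc m ∸ k * suc m ≡⟨ *-distribʳ-∸ (suc m) n k ⟨
    (n ∸ k) * suc m       ∎
    where open ≤-Reasoning

  entropy-bound : ∀ m n k c V .{{_ : NonZero m}} → k * suc m ≤ n →
    2 ^ n ≤ c * V → V * m ^ (n ∸ k) ≤ suc m ^ n →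
    2 ^ (suc m * n) * m ^ (m * n) ≤ c ^ suc m * suc m ^ (suc m * n)
  entropy-bound m n k c V k[1+m]≤n covering volume = begin
    2 ^ (l * n) * m ^ (m * n)
      ≤⟨ *-monoʳ-≤ (2 ^ (l * n)) (^-monoʳ-≤ m (m*n≤[n∸k]*[1+m] m n k k[1+m]≤n)) ⟩
    2 ^ (l * n) * m ^ ((n ∸ k) * l)
      ≡⟨ cong₂ _*_ (trans (cong (2 ^_) (*-comm l n)) (sym (^-*-assoc 2 n l))) (sym (^-*-assoc m (n ∸ k) l)) ⟩
    (2 ^ n) ^ l * M ^ l
      ≡⟨ ^-distribʳ-* (2 ^ n) M l ⟨
    (2 ^ n * M) ^ l
      ≤⟨ ^-monoˡ-≤ l (*-monoˡ-≤ M covering) ⟩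
    (c * V * M) ^ l
      ≡⟨ cong (_^ l) (*-assoc c V M) ⟩
    (c * (V * M)) ^ l
      ≤⟨ ^-monoˡ-≤ l (*-monoʳ-≤ c volume) ⟩
    (c * l ^ n) ^ l
      ≡⟨ ^-distribʳ-* c (l ^ n) l ⟩
    c ^ l * (l ^ n) ^ l
      ≡⟨ cong (c ^ l *_) (trans (^-*-assoc l n l) (cong (l ^_) (*-comm n l))) ⟩
    c ^ l * l ^ (l * n) ∎
    where
    open ≤-Reasoning
    l M : ℕ
    l = suc m
    M = m ^ (n ∸ k)

module ConvexHullCovering where

  open import Data.Nat as ℕ using (ℕ; zero; suc)
  import Data.Nat.Properties as ℕ
  open import Data.Nat.DivMod using (_/_)
  open import Data.Rational using (ℚ; 0ℚ; 1ℚ; _+_; _*_; _-_; -_; _≤_; _<_; 1/_; NonZero; Positive; positive)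
  open import Data.Rational.Properties
  open import Data.Rational.Solver using (module +-*-Solver)
  open +-*-Solver
  open import Data.Empty using (⊥-elim)
  open import Data.Fin using (Fin) renaming (zero to fzero; suc to fsuc)
  open import Data.Fin.Subset using (Subset; ∣_∣)
  open import Data.List.Relation.Unary.All as All using (All; []; _∷_)
  open import Data.List.Relation.Unary.All.Properties using (¬Any⇒All¬)
  open import Data.List.Relation.Unary.Any as Any using (any?)
  open import Data.Product using (proj₁; proj₂)
  open import Relation.Nullary using (yes; no)
  open import Algebra.Bundles using (Ring; Semiring)
  open import Level using (0ℓ)
  open SphereCovering using (𝟙; hamming; m*n≤o⇒n≤o/m)

  ℚ-semiring : Semiring 0ℓ 0ℓ
  ℚ-semiring = Ring.semiring +-*-ring

  open import Algebra.Properties.Semiring.Sum ℚ-semiring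
    using (sum; sum-syntax; ∑-distrib-+; sum-cong-≗; sum-replicate; sum-replicate-zero)
  open import Algebra.Properties.Semiring.Mult ℚ-semiring
    using (×-homo-+; ×-assocˡ; ×-assoc-*) renaming (_×_ to _·_)
  open import Algebra.Properties.CommutativeMonoid.Mult (Semiring.+-commutativeMonoid ℚ-semiring)
    using (×-distrib-+)

  0≤1 : 0ℚ ≤ 1ℚ
  0≤1 = <⇒≤ (positive⁻¹ 1ℚ)

  ·-zeroʳ : ∀ n → n · 0ℚ ≡ 0ℚ
  ·-zeroʳ zero    = refl
  ·-zeroʳ (suc n) = trans (+-identityˡ (n · 0ℚ)) (·-zeroʳ n)

  ·-nonNeg : ∀ n {x} → 0ℚ ≤ x → 0ℚ ≤ n · x
  ·-nonNeg zero    0≤x = ≤-refl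
  ·-nonNeg (suc n) 0≤x = +-mono-≤ 0≤x (·-nonNeg n 0≤x)

  ·-monoˡ-≤ : ∀ {x} → 0ℚ ≤ x → ∀ {a b} → a ℕ.≤ b → a · x ≤ b · x
  ·-monoˡ-≤ {x} 0≤x {a} {b} a≤b = begin
    a · x                 ≡⟨ +-identityʳ (a · x) ⟨
    a · x + 0ℚ            ≤⟨ +-monoʳ-≤ (a · x) (·-nonNeg (b ℕ.∸ a) 0≤x) ⟩
    a · x + (b ℕ.∸ a) · x ≡⟨ ×-homo-+ x a (b ℕ.∸ a) ⟨
    (a ℕ.+ (b ℕ.∸ a)) · x ≡⟨ cong (_· x) (ℕ.m+[n∸m]≡n a≤b) ⟩
    b · x                 ∎
    where open ≤-Reasoning

  x<1+x : ∀ x → x < 1ℚ + x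
  x<1+x x = subst (_< 1ℚ + x) (+-identityˡ x) (+-mono-<-≤ (positive⁻¹ 1ℚ) (≤-refl {x}))

  sumFin≡sum : ∀ {n} (f : Fin n → ℚ) → sumFin f ≡ sum f
  sumFin≡sum {zero}  f = refl
  sumFin≡sum {suc n} f = cong (f fzero +_) (sumFin≡sum (f ∘ fsuc))

  sum-mono-≤ : ∀ {n} {f g : Fin n → ℚ} → (∀ i → f i ≤ g i) → sum f ≤ sum g
  sum-mono-≤ {zero}  f≤g = ≤-refl
  sum-mono-≤ {suc n} f≤g = +-mono-≤ (f≤g fzero) (sum-mono-≤ (f≤g ∘ fsuc))

  ∑-if-lookup : ∀ {n} (P : Subset n) c → ∑[ i < n ] (if lookup P i then c else 0ℚ) ≡ ∣ P ∣ · c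
  ∑-if-lookup []          c = refl
  ∑-if-lookup (true ∷ P)  c = cong (c +_) (∑-if-lookup P c)
  ∑-if-lookup (false ∷ P) c = trans (+-identityˡ _) (∑-if-lookup P c)

  if-mono-≤ : ∀ b {x y} → x ≤ y → (if b then x else 0ℚ) ≤ (if b then y else 0ℚ)
  if-mono-≤ true  x≤y = x≤y
  if-mono-≤ false _   = ≤-refl

  -- gap t b x is the distance from x ∈ [0, t] to the end b of [0, t]; carrying the total
  -- weight t makes it additive over weighted lists of vertices.
  gap : ℚ → Bool → ℚ → ℚ
  gap t true  x = t - x
  gap t false x = x

  dist₁ : ∀ {n} → Cube n → Point n → ℚ
  dist₁ {n} y x = ∑[ i < n ] gap 1ℚ (lookup y i) (x i)

  expectedDistance : ∀ {n} → Cube n → List (ℚ × Cube n) → ℚ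
  expectedDistance y []             = 0ℚ
  expectedDistance y ((w , v) ∷ ws) = hamming v y · w + expectedDistance y ws

  gap-cons : ∀ w t a b c → gap (w + t) b (w * bit a + c) ≡ 𝟙 (a xor b) · w + gap t b c
  gap-cons w t true  true  c = solve 3 (λ w t c → (w :+ t) :- (w :* con 1ℚ :+ c) := con 0ℚ :+ (t :- c)) refl w t c
  gap-cons w t false true  c = solve 3 (λ w t c → (w :+ t) :- (w :* con 0ℚ :+ c) := (w :+ con 0ℚ) :+ (t :- c)) refl w t c
  gap-cons w t true  false c = solve 2 (λ w c → w :* con 1ℚ :+ c := (w :+ con 0ℚ) :+ c) refl w c
  gap-cons w t false false c = solve 2 (λ w c → w :* con 0ℚ :+ c := con 0ℚ :+ c) refl w c

  ∑-xor-·≡hamming-· : ∀ {n} (u v : Cube n) w → ∑[ i < n ] (𝟙 (lookup u i xor lookup v i) · w) ≡ hamming u v · w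
  ∑-xor-·≡hamming-· []      []      w = refl
  ∑-xor-·≡hamming-· (a ∷ u) (b ∷ v) w =
    trans (cong (𝟙 (a xor b) · w +_) (∑-xor-·≡hamming-· u v w)) (sym (×-homo-+ w (𝟙 (a xor b)) (hamming u v)))

  ∑-gap-combo : ∀ {n} (y : Cube n) ws →
    ∑[ i < n ] gap (sumW ws) (lookup y i) (combo ws i) ≡ expectedDistance y ws
  ∑-gap-combo {n} y [] = trans (sum-cong-≗ (λ i → gap-zero (lookup y i))) (sum-replicate-zero n)
    where
    gap-zero : ∀ b → gap 0ℚ b 0ℚ ≡ 0ℚ
    gap-zero true  = refl
    gap-zero false = refl
  ∑-gap-combo {n} y ((w , v) ∷ ws) = begin
    ∑[ i < n ] gap (w + sumW ws) (lookup y i) (w * bit (lookup v i) + combo ws i)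
      ≡⟨ sum-cong-≗ (λ i → gap-cons w (sumW ws) (lookup v i) (lookup y i) (combo ws i)) ⟩
    ∑[ i < n ] (𝟙 (lookup v i xor lookup y i) · w + gap (sumW ws) (lookup y i) (combo ws i))
      ≡⟨ ∑-distrib-+ {n} _ _ ⟩
    ∑[ i < n ] (𝟙 (lookup v i xor lookup y i) · w) + ∑[ i < n ] gap (sumW ws) (lookup y i) (combo ws i)
      ≡⟨ cong₂ _+_ (∑-xor-·≡hamming-· v y w) (∑-gap-combo y ws) ⟩
    hamming v y · w + expectedDistance y ws ∎
    where open ≡-Reasoning

  dist₁-combo : ∀ {n} (y : Cube n) ws → sumW ws ≡ 1ℚ → dist₁ y (combo ws) ≡ expectedDistance y ws
  dist₁-combo {n} y ws Σw≡1 =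
    subst (λ t → ∑[ i < n ] gap t (lookup y i) (combo ws i) ≡ expectedDistance y ws) Σw≡1 (∑-gap-combo y ws)

  expectedDistance-bound : ∀ {n} t c (y : Cube n) ws →
    All (λ q → 0ℚ ≤ proj₁ q) ws → All (λ q → t ℕ.≤ c ℕ.* hamming (proj₂ q) y) ws →
    t · sumW ws ≤ c · expectedDistance y ws
  expectedDistance-bound t c y [] [] [] = ≤-reflexive (trans (·-zeroʳ t) (sym (·-zeroʳ c)))
  expectedDistance-bound t c y ((w , v) ∷ ws) (0≤w ∷ 0≤ws) (far ∷ fars) = begin
    t · (w + sumW ws)
      ≡⟨ ×-distrib-+ w (sumW ws) t ⟩
    t · w + t · sumW ws
      ≤⟨ +-mono-≤ (·-monoˡ-≤ 0≤w far) (expectedDistance-bound t c y ws 0≤ws fars) ⟩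
    (c ℕ.* hamming v y) · w + c · E
      ≡⟨ cong (_+ c · E) (×-assocˡ w c (hamming v y)) ⟨
    c · (hamming v y · w) + c · E
      ≡⟨ ×-distrib-+ (hamming v y · w) E c ⟨
    c · (hamming v y · w + E) ∎
    where
    open ≤-Reasoning
    E : ℚ
    E = expectedDistance y ws

  module _ (m : ℕ) .{{_ : ℕ.NonZero m}} where

    private
      l : ℕ
      l = suc m

      L : ℚ
      L = l · 1ℚ

      instance
        L-positive : Positive L
        L-positive = positive (+-mono-<-≤ (positive⁻¹ 1ℚ) (·-nonNeg m 0≤1))

        L-nonZero : NonZero L
        L-nonZero = pos⇒nonZero L

    r : ℚ
    r = 1/ L

    l·r≡1 : l · r ≡ 1ℚ
    l·r≡1 = begin
      l · r        ≡⟨ cong (l ·_) (*-identityˡ r) ⟨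
      l · (1ℚ * r) ≡⟨ ×-assoc-* l 1ℚ r ⟨
      L * r        ≡⟨ *-inverseʳ L ⟩
      1ℚ           ∎
      where open ≡-Reasoning

    0≤r : 0ℚ ≤ r
    0≤r = <⇒≤ (positive⁻¹ r {{1/pos⇒pos L}})

    r≤1-r : r ≤ 1ℚ - r
    r≤1-r = begin
      r         ≡⟨ solve 1 (λ r → r := (r :+ (r :+ con 0ℚ)) :- r) refl r ⟩
      2 · r - r ≤⟨ +-monoˡ-≤ (- r) 2·r≤1 ⟩
      1ℚ - r    ∎
      where
      open ≤-Reasoning
      2·r≤1 : 2 · r ≤ 1ℚ
      2·r≤1 = ≤-trans (·-monoˡ-≤ 0≤r (ℕ.s≤s (ℕ.>-nonZero⁻¹ m))) (≤-reflexive l·r≡1)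

    1-r≤1 : 1ℚ - r ≤ 1ℚ
    1-r≤1 = begin
      1ℚ - r        ≡⟨ +-identityʳ (1ℚ - r) ⟨
      1ℚ - r + 0ℚ   ≤⟨ +-monoʳ-≤ (1ℚ - r) 0≤r ⟩
      1ℚ - r + r    ≡⟨ solve 1 (λ r → con 1ℚ :- r :+ r := con 1ℚ) refl r ⟩
      1ℚ            ∎
      where open ≤-Reasoning

    1-[1-r]≡r : 1ℚ - (1ℚ - r) ≡ r
    1-[1-r]≡r = solve 1 (λ r → con 1ℚ :- (con 1ℚ :- r) := r) refl r

    fracVertex : ∀ {n} → Cube n → Point n
    fracVertex y i = if lookup y i then 1ℚ - r else r

    r≤fracVertex : ∀ {n} (y : Cube n) i → r ≤ fracVertex y i
    r≤fracVertex y i with lookup y i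
    ... | true  = r≤1-r
    ... | false = ≤-refl

    r≤1-fracVertex : ∀ {n} (y : Cube n) i → r ≤ 1ℚ - fracVertex y i
    r≤1-fracVertex y i with lookup y i
    ... | true  = ≤-reflexive (sym 1-[1-r]≡r)
    ... | false = r≤1-r

    fracVertex≤1 : ∀ {n} (y : Cube n) i → fracVertex y i ≤ 1ℚ
    fracVertex≤1 y i with lookup y i
    ... | true  = 1-r≤1
    ... | false = ≤-trans r≤1-r 1-r≤1

    fracVertex-satGSC : ∀ {n} (y : Cube n) (g : GSC n) → l ℕ.≤ gscSize g → SatGSC g (fracVertex y)
    fracVertex-satGSC {n} y g l≤size = begin
      1ℚ                          ≡⟨ l·r≡1 ⟨
      l · r                       ≤⟨ ·-monoˡ-≤ 0≤r l≤size ⟩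
      (∣ I ∣ ℕ.+ ∣ J ∣) · r       ≡⟨ ×-homo-+ r ∣ I ∣ ∣ J ∣ ⟩
      ∣ I ∣ · r + ∣ J ∣ · r       ≡⟨ cong₂ _+_ (∑-if-lookup I r) (∑-if-lookup J r) ⟨
      ∑[ i < n ] (if lookup I i then r else 0ℚ) + ∑[ i < n ] (if lookup J i then r else 0ℚ)
        ≤⟨ +-mono-≤ (sum-mono-≤ (λ i → if-mono-≤ (lookup I i) (r≤fracVertex y i)))
                    (sum-mono-≤ (λ i → if-mono-≤ (lookup J i) (r≤1-fracVertex y i))) ⟩
      ∑[ i < n ] (if lookup I i then fracVertex y i else 0ℚ)
        + ∑[ i < n ] (if lookup J i then 1ℚ - fracVertex y i else 0ℚ)
        ≡⟨ cong₂ _+_ (sumFin≡sum {n} _) (sumFin≡sum {n} _) ⟨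
      gscLHS g (fracVertex y)     ∎
      where
      open ≤-Reasoning
      I J : Subset n
      I = GSC.I g
      J = GSC.J g

    fracVertex∈conv : ∀ {n} (S : SetSystem n) → CubeIdeal S → (∀ g → ValidGSC S g → l ℕ.≤ gscSize g) →
      (y : Cube n) → InConv S (fracVertex y)
    fracVertex∈conv S (F , conv⇔F) l≤size y = proj₂ (conv⇔F (fracVertex y)) (All.tabulate satisfied)
      where
      satisfied : ∀ {e} → e ∈ F → Sat e (fracVertex y)
      satisfied {lower i} _   = ≤-trans 0≤r (r≤fracVertex y i)
      satisfied {upper i} _   = fracVertex≤1 y i
      satisfied {cover g} g∈F = fracVertex-satGSC y g (l≤size g (λ x x∈conv → All.lookup (proj₁ (conv⇔F x) x∈conv) g∈F))

    dist₁-fracVertex : ∀ {n} (y : Cube n) → dist₁ y (fracVertex y) ≡ n · r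
    dist₁-fracVertex {n} y = trans (sum-cong-≗ (λ i → gap-fracVertex (lookup y i))) (sum-replicate n)
      where
      gap-fracVertex : ∀ b → gap 1ℚ b (if b then 1ℚ - r else r) ≡ r
      gap-fracVertex true  = 1-[1-r]≡r
      gap-fracVertex false = refl

    cube-ideal⇒covering : ∀ {n} (S : SetSystem n) → CubeIdeal S → (∀ g → ValidGSC S g → l ℕ.≤ gscSize g) →
      ∀ y → ∃[ s ] T (S s) × hamming s y ℕ.≤ n / l
    cube-ideal⇒covering {n} S ideal l≤size y with fracVertex∈conv S ideal l≤size y
    ... | ws , support , Σw≡1 , y≡combo with any? (λ q → l ℕ.* hamming (proj₂ q) y ℕ.≤? n) ws
    ...   | yes close =
      let (s∈S , _) , l*d≤n = All.lookupAny support close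
      in proj₂ (Any.lookup close) , s∈S , m*n≤o⇒n≤o/m l l*d≤n
    ...   | no ¬close = ⊥-elim (<-irrefl refl (<-≤-trans (x<1+x (n · 1ℚ)) too-far))
      where
      too-far : suc n · 1ℚ ≤ n · 1ℚ
      too-far = begin
        suc n · 1ℚ                   ≡⟨ cong (suc n ·_) Σw≡1 ⟨
        suc n · sumW ws              ≤⟨ expectedDistance-bound (suc n) l y ws (All.map proj₂ support)
                                          (All.map ℕ.≰⇒> (¬Any⇒All¬ ws ¬close)) ⟩
        l · expectedDistance y ws    ≡⟨ cong (l ·_) (dist₁-combo y ws Σw≡1) ⟨
        l · dist₁ y (combo ws)       ≡⟨ cong (l ·_) (sum-cong-≗ (λ i → cong (gap 1ℚ (lookup y i)) (y≡combo i))) ⟨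
        l · dist₁ y (fracVertex y)   ≡⟨ cong (l ·_) (dist₁-fracVertex y) ⟩
        l · (n · r)                  ≡⟨ ×-assocˡ r l n ⟩
        (l ℕ.* n) · r                ≡⟨ cong (_· r) (ℕ.*-comm l n) ⟩
        (n ℕ.* l) · r                ≡⟨ ×-assocˡ r n l ⟨
        n · (l · r)                  ≡⟨ cong (n ·_) l·r≡1 ⟩
        n · 1ℚ                       ∎
        where open ≤-Reasoning

open import Data.Nat using (ℕ; _≤_; suc; s≤s)
open import Data.Nat.DivMod using (_/_; m/n*n≤m)
open SphereCovering using (full⇒2^n≤card; ballVolume; sphere-covering-bound; ballVolume-bound; entropy-bound)
open ConvexHullCovering using (cube-ideal⇒covering)

theorem1p1 : (n : ℕ) → 1 ≤ n → (S : SetSystem n) → CubeIdeal S →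
    (λc : ℕ∞) → Connectivity S λc → 3 ≤∞ λc →
    EntropyBound n λc (card S)
theorem1p1 n _ S ideal (fin (suc m@(suc _))) (_ , λ≤size) (s≤s (s≤s (s≤s _))) =
  entropy-bound m n k (card S) (ballVolume n k) (m/n*n≤m n (suc m))
    (sphere-covering-bound S k (cube-ideal⇒covering m S ideal λ≤size))
    (ballVolume-bound m n k)
  where
  k : ℕ
  k = n / suc m
theorem1p1 n _ S _ ∞ full _ = full⇒2^n≤card S full
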